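{- Let $n\ge 1$ and let $f^n$ be the canonical $Q_n$-parking function. Then $f^n(v)=\mathrm{wgt}(v)-1$ for every $v\in V(Q_n)$, where $\mathrm{wgt}(v)$ is the number of 1's in the binary vector $v$. Consequently, if $f$ is a semi-canonical $Q_n$-parking function, then $$|\mathrm{dom}(f)|=\prod_{k=2}^{n}k^{\binom{n}{k}}.$$
   Context: $Q_n$ is the graph whose vertices are the binary vectors of length $n$, two vertices adjacent iff they differ in exactly one coordinate; parking functions on $Q_n$ are taken with respect to $q=(0,\dots,0)$. For a graph $G=(V,E)$, $A\subseteq V$, $v\in A$, $d_{\overline{A}}(v)$ is the number of edges $vw$ with $w\notin A$; a $G$-parking function with respect to $q$ is $f:V\to\mathbb{Z}_{\geq -1}$ with $f(q)=-1$ such that every non-empty $A\subseteq V\setminus\{q\}$ contains $v$ with $0\le f(v)<d_{\overline{A}}(v)$. For parking functions $f_1$ on $G_1$ (w.r.t. $q_1$) and $f_2$ on $G_2$ (w.r.t. $q_2$), define $f_1\Box f_2$ on the Cartesian product $G_1\Box G_2$ (vertex set $V_1\times V_2$, $(u,v)\sim(u',v)$ iff $u\sim u'$ in $G_1$, $(u,v)\sim(u,v')$ iff $v\sim v'$ in $G_2$) by $(f_1\Box f_2)(u,v)=f_1(u)+f_2(v)+1$. The canonical $Q_1$-parking function is $f^1(0)=-1$, $f^1(1)=0$, and the canonical $Q_n$-parking function is $f^n=f^1\Box f^1\Box\cdots\Box f^1$ ($n$ factors), with $Q_n=Q_1\Box\cdots\Box Q_1$ and vertices identified with binary vectors. A $Q_n$-parking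 function $g$ is semi-canonical if there is a bijection $\phi:V(Q_n)\to V(Q_n)$ with $f^n(v)=g(\phi(v))$ for all $v$. For a parking function $f$, $\mathrm{dom}(f)$ is the set of $Q_n$-parking functions $g$ (w.r.t. $q$) with $g(v)\le f(v)$ for all $v$. -}

module Defs where

open import Data.Bool using (Bool; true; false; not)
open import Data.Nat using (ℕ; zero; suc; _^_)
open import Data.Nat.Combinatorics using (_C_)
open import Data.Integer using (ℤ; +_; _+_; _-_; _≤_; _<_; -1ℤ; 0ℤ; 1ℤ)
open import Data.Fin using (Fin)
open import Data.Vec using (Vec; []; _∷_; replicate; updateAt; count)
open import Data.List using (List; length; map; applyUpTo)
open import Data.Nat.ListAction using (product)
open import Data.List.Membership.Propositional using (_∈_)
open import Data.List.Relation.Unary.Any using (Any)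
open import Data.List.Relation.Unary.AllPairs using (AllPairs)
open import Data.Product using (Σ; ∃; _×_; _,_)
open import Relation.Binary.PropositionalEquality using (_≡_; _≗_)
open import Relation.Nullary using (¬_)
open import Function.Definitions using (Bijective)
import Data.Bool.Properties as BoolP

V : ℕ → Set
V n = Vec Bool n

q : (n : ℕ) → V n
q n = replicate n false

-- The neighbours of v in Q_n are exactly the vectors differing from v in
-- exactly one coordinate, i.e. flip i v for i : Fin n (one per coordinate).
flip : ∀ {n} → Fin n → V n → V n
flip i v = updateAt v i not

-- d_{Ā}(v) for a subset A ⊆ V (given by its characteristic function):
-- number of edges v w of Q_n with w ∉ A.
dOut : ∀ {n} → (V n → Bool) → V n → ℕ
dOut {n} A v = count (λ i → A (flip i v) BoolP.≟ false) (Data.Vec.allFin n)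
  where import Data.Vec

IsParking : (n : ℕ) → (V n → ℤ) → Set
IsParking n f =
  (f (q n) ≡ -1ℤ) ×
  (∀ v → -1ℤ ≤ f v) ×
  (∀ (A : V n → Bool) → A (q n) ≡ false → (∃ λ v → A v ≡ true) →
     ∃ λ v → (A v ≡ true) × (0ℤ ≤ f v) × (f v < + dOut A v))

_□_ : ∀ {A B : Set} → (A → ℤ) → (B → ℤ) → (A × B → ℤ)
(f₁ □ f₂) (a , b) = f₁ a + f₂ b + 1ℤ

f¹ : Bool → ℤ
f¹ false = -1ℤ
f¹ true  = 0ℤ

-- Canonical Q_{m+1}-parking function f^{m+1} = f¹ □ (f¹ □ ⋯ □ f¹),
-- with Q_{m+1} = Q_1 □ Q_m identified with binary vectors via (b , v) ↦ b ∷ v.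
canonical : (m : ℕ) → V (suc m) → ℤ
canonical zero    (b ∷ []) = f¹ b
canonical (suc m) (b ∷ v)  = (f¹ □ canonical m) (b , v)

wgt : ∀ {n} → V n → ℕ
wgt v = count (λ b → b BoolP.≟ true) v

SemiCanonical : (m : ℕ) → (V (suc m) → ℤ) → Set
SemiCanonical m g =
  IsParking (suc m) g ×
  Σ (V (suc m) → V (suc m)) λ φ → Bijective _≡_ _≡_ φ × (∀ v → canonical m v ≡ g (φ v))

InDom : (n : ℕ) → (V n → ℤ) → (V n → ℤ) → Set
InDom n f g = IsParking n g × (∀ v → g v ≤ f v)

-- |dom(f)| = N : there is a duplicate-free (up to pointwise equality of functions)
-- list of length N enumerating exactly dom(f).
DomCard : (n : ℕ) → (V n → ℤ) → ℕ → Set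
DomCard n f N = Σ (List (V n → ℤ)) λ L →
  (length L ≡ N) ×
  (∀ {g} → g ∈ L → InDom n f g) ×
  (∀ g → InDom n f g → Any (λ h → g ≗ h) L) ×
  AllPairs (λ g h → ¬ (g ≗ h)) L

prodFormula : ℕ → ℕ
prodFormula n = product (map (λ j → (suc (suc j)) ^ (n C (suc (suc j)))) (applyUpTo (λ j → j) (n Data.Nat.∸ 1)))
  where import Data.Nat

-- For any parking function f, dom(f) is a box: g ∈ dom(f) iff g(q) = -1 and
-- 0 ≤ g(v) ≤ f(v) for v ≠ q. Nonnegativity off q comes from the parking condition on singletons,
-- and conversely every such g is parking because f's witness for a set A also works for g.
-- Hence |dom(f)| = ∏_{v ≠ q} (f(v) + 1). A semi-canonical f is f^n up to relabelling the vertices,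
-- and f^n(v) = wgt(v) - 1, so the product is ∏_k k^(n choose k), which follows by splitting
-- the cube along its first coordinate and using Pascal's rule.
module Submission where

open import Defs
open import Data.Bool using (true; false)
open import Data.Nat as ℕ using (ℕ; zero; suc; _*_; _^_; _⊔_; z≤n; s≤s)
import Data.Nat.Properties as ℕ
open import Data.Nat.Combinatorics using (_C_; nCk+nC[k+1]≡[n+1]C[k+1]; k>n⇒nCk≡0)
open import Data.Nat.ListAction using (product)
open import Data.Nat.ListAction.Properties using (product-++)
open import Data.Integer using (ℤ; +_; -[1+_]; _+_; _-_; _≤_; _<_; 1ℤ; -1ℤ; 0ℤ; +≤+; -≤+)
import Data.Integer.Properties as ℤ
open import Data.Integer.Solver using (module +-*-Solver)
open import Data.List using (List; []; _∷_; _++_; map; length; applyUpTo; upTo; cartesianProductWith)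
open import Data.List.Properties using (length-map; length-++; length-upTo; map-++; map-∘; map-cong; map-applyUpTo; ++-identityʳ)
open import Data.List.Membership.Propositional using (_∈_)
open import Data.List.Membership.Propositional.Properties
  using (∈-map⁺; ∈-map⁻; ∈-upTo⁺; ∈-upTo⁻; ∈-cartesianProductWith⁺; ∈-cartesianProductWith⁻)
open import Data.List.Relation.Unary.Any as Any using (Any; here; there)
import Data.List.Relation.Unary.Any.Properties as Any
import Data.List.Relation.Unary.AllPairs as AllPairs
open import Data.List.Relation.Unary.Unique.Propositional using (Unique; []; _∷_)
import Data.List.Relation.Unary.Unique.Propositional.Properties as Unique
import Data.List.Relation.Unary.Unique.Setoid as SetoidUnique
import Data.List.Relation.Unary.Unique.Setoid.Properties as SetoidUnique
open import Data.Vec using ([]; _∷_)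
open import Data.Vec.Properties using (∷-injective; ≡-dec)
import Data.Bool.Properties as Bool
open import Data.Product using (∃; _×_; _,_; proj₁; proj₂)
open import Function using (_∘_; id)
open import Relation.Binary.Bundles using (Setoid)
open import Relation.Binary.Definitions using (DecidableEquality)
open import Relation.Binary.PropositionalEquality
open import Relation.Nullary using (yes; no; does; contradiction)
open import Relation.Nullary.Decidable using (dec-true; dec-false)
import Data.List.Relation.Unary.All as All

powProduct : (ℕ → ℕ) → (ℕ → ℕ) → ℕ → ℕ
powProduct F e N = product (applyUpTo (λ j → F j ^ e j) N)

powProduct-cong : ∀ F {e e′} N → (∀ j → e j ≡ e′ j) → powProduct F e N ≡ powProduct F e′ N
powProduct-cong F zero    e≡e′ = refl
powProduct-cong F (suc N) e≡e′ =
  cong₂ (λ a b → F 0 ^ a * b) (e≡e′ 0) (powProduct-cong (F ∘ suc) N (e≡e′ ∘ suc))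

powProduct-+ : ∀ F e e′ N → powProduct F (λ j → e j ℕ.+ e′ j) N ≡ powProduct F e N * powProduct F e′ N
powProduct-+ F e e′ zero    = refl
powProduct-+ F e e′ (suc N) = begin
  F 0 ^ (e 0 ℕ.+ e′ 0) * powProduct (F ∘ suc) (λ j → e (suc j) ℕ.+ e′ (suc j)) N
    ≡⟨ cong₂ _*_ (ℕ.^-distribˡ-+-* (F 0) (e 0) (e′ 0)) (powProduct-+ (F ∘ suc) (e ∘ suc) (e′ ∘ suc) N) ⟩
  (F 0 ^ e 0 * F 0 ^ e′ 0) * (powProduct (F ∘ suc) (e ∘ suc) N * powProduct (F ∘ suc) (e′ ∘ suc) N)
    ≡⟨ interchange (F 0 ^ e 0) (F 0 ^ e′ 0) (powProduct (F ∘ suc) (e ∘ suc) N) _ ⟩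
  (F 0 ^ e 0 * powProduct (F ∘ suc) (e ∘ suc) N) * (F 0 ^ e′ 0 * powProduct (F ∘ suc) (e′ ∘ suc) N) ∎
  where
  open ≡-Reasoning
  open import Algebra.Properties.CommutativeSemigroup ℕ.*-commutativeSemigroup using (interchange)

powProduct-suc : ∀ F e N → e N ≡ 0 → powProduct F e (suc N) ≡ powProduct F e N
powProduct-suc F e zero    eN≡0 rewrite eN≡0 = refl
powProduct-suc F e (suc N) eN≡0 = cong (F 0 ^ e 0 *_) (powProduct-suc (F ∘ suc) (e ∘ suc) N eN≡0)

binomialProduct : (ℕ → ℕ) → ℕ → ℕ
binomialProduct F n = powProduct F (n C_) (suc n)

binomialProduct-suc : ∀ F n → binomialProduct F (suc n) ≡ binomialProduct F n * binomialProduct (F ∘ suc) n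
binomialProduct-suc F n = begin
  F 0 ^ 1 * powProduct (F ∘ suc) (λ k → suc n C suc k) (suc n)
    ≡⟨ cong (F 0 ^ 1 *_) (powProduct-cong (F ∘ suc) (suc n) (λ k → sym (nCk+nC[k+1]≡[n+1]C[k+1] n k))) ⟩
  F 0 ^ 1 * powProduct (F ∘ suc) (λ k → n C k ℕ.+ n C suc k) (suc n)
    ≡⟨ cong (F 0 ^ 1 *_) (powProduct-+ (F ∘ suc) (n C_) (λ k → n C suc k) (suc n)) ⟩
  F 0 ^ 1 * (binomialProduct (F ∘ suc) n * powProduct (F ∘ suc) (λ k → n C suc k) (suc n))
    ≡⟨ cong (λ x → F 0 ^ 1 * (binomialProduct (F ∘ suc) n * x))
            (powProduct-suc (F ∘ suc) (λ k → n C suc k) n (k>n⇒nCk≡0 (ℕ.n<1+n n))) ⟩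
  F 0 ^ 1 * (binomialProduct (F ∘ suc) n * powProduct (F ∘ suc) (λ k → n C suc k) n)
    ≡⟨ cong (F 0 ^ 1 *_) (ℕ.*-comm (binomialProduct (F ∘ suc) n) _) ⟩
  F 0 ^ 1 * (powProduct (F ∘ suc) (λ k → n C suc k) n * binomialProduct (F ∘ suc) n)
    ≡⟨ ℕ.*-assoc (F 0 ^ 1) _ _ ⟨
  binomialProduct F n * binomialProduct (F ∘ suc) n ∎
  where open ≡-Reasoning

vertices : (n : ℕ) → List (V n)
vertices zero    = [] ∷ []
vertices (suc n) = cartesianProductWith _∷_ (false ∷ true ∷ []) (vertices n)

∈-vertices : ∀ {n} (v : V n) → v ∈ vertices n
∈-vertices []          = here refl
∈-vertices (false ∷ v) = ∈-cartesianProductWith⁺ _∷_ {xs = false ∷ true ∷ []} (here refl) (∈-vertices v)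
∈-vertices (true ∷ v)  = ∈-cartesianProductWith⁺ _∷_ {xs = false ∷ true ∷ []} (there (here refl)) (∈-vertices v)

vertices-unique : ∀ n → Unique (vertices n)
vertices-unique zero    = All.[] ∷ []
vertices-unique (suc n) =
  Unique.cartesianProductWith⁺ _∷_ ∷-injective (((λ ()) All.∷ All.[]) ∷ All.[] ∷ []) (vertices-unique n)

product-vertices : ∀ F n → product (map (F ∘ wgt) (vertices n)) ≡ binomialProduct F n
product-vertices F zero    = sym (ℕ.*-identityʳ _)
product-vertices F (suc n) = begin
  product (map (F ∘ wgt) (map (false ∷_) vs ++ (map (true ∷_) vs ++ [])))
    ≡⟨ cong (λ ws → product (map (F ∘ wgt) (map (false ∷_) vs ++ ws))) (++-identityʳ _) ⟩
  product (map (F ∘ wgt) (map (false ∷_) vs ++ map (true ∷_) vs))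
    ≡⟨ cong product (map-++ (F ∘ wgt) (map (false ∷_) vs) _) ⟩
  product (map (F ∘ wgt) (map (false ∷_) vs) ++ map (F ∘ wgt) (map (true ∷_) vs))
    ≡⟨ product-++ (map (F ∘ wgt) (map (false ∷_) vs)) _ ⟩
  product (map (F ∘ wgt) (map (false ∷_) vs)) * product (map (F ∘ wgt) (map (true ∷_) vs))
    ≡⟨ cong₂ _*_ (cong product (map-∘ vs)) (cong product (map-∘ vs)) ⟨
  product (map (F ∘ wgt) vs) * product (map (F ∘ suc ∘ wgt) vs)
    ≡⟨ cong₂ _*_ (product-vertices F n) (product-vertices (F ∘ suc) n) ⟩
  binomialProduct F n * binomialProduct (F ∘ suc) n
    ≡⟨ binomialProduct-suc F n ⟨
  binomialProduct F (suc n) ∎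
  where
  open ≡-Reasoning
  vs = vertices n

binomialProduct-prodFormula : ∀ m → binomialProduct (1 ⊔_) (suc m) ≡ prodFormula (suc m)
binomialProduct-prodFormula m = begin
  1 * (1 ^ (suc m C 1) * rest)  ≡⟨ ℕ.*-identityˡ _ ⟩
  1 ^ (suc m C 1) * rest        ≡⟨ cong (_* rest) (ℕ.^-zeroˡ (suc m C 1)) ⟩
  1 * rest                      ≡⟨ ℕ.*-identityˡ rest ⟩
  product (applyUpTo factor m)  ≡⟨ cong product (map-applyUpTo id factor m) ⟨
  prodFormula (suc m)           ∎
  where
  open ≡-Reasoning
  factor : ℕ → ℕ
  factor j = suc (suc j) ^ (suc m C suc (suc j))
  rest : ℕ
  rest = powProduct (λ j → suc (suc j)) (λ j → suc m C suc (suc j)) m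

length-cartesianProductWith : ∀ {A B C : Set} (f : A → B → C) xs ys →
  length (cartesianProductWith f xs ys) ≡ length xs * length ys
length-cartesianProductWith f []       ys = refl
length-cartesianProductWith f (x ∷ xs) ys =
  trans (length-++ (map (f x) ys)) (cong₂ ℕ._+_ (length-map (f x) ys) (length-cartesianProductWith f xs ys))

module Selections {X A : Set} (_≟_ : DecidableEquality X) (default : A) (S : X → List A) where

  _[_≔_] : (X → A) → X → A → X → A
  (g [ v ≔ c ]) x with x ≟ v
  ... | yes _ = c
  ... | no  _ = g x

  update-≡ : ∀ g v c → (g [ v ≔ c ]) v ≡ c
  update-≡ g v c with v ≟ v
  ... | yes _   = refl
  ... | no  v≢v = contradiction refl v≢v

  update-≢ : ∀ g {v x} c → x ≢ v → (g [ v ≔ c ]) x ≡ g x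
  update-≢ g {v} {x} c x≢v with x ≟ v
  ... | yes x≡v = contradiction x≡v x≢v
  ... | no  _   = refl

  _≗[_]_ : (X → A) → List X → (X → A) → Set
  g ≗[ vs ] h = ∀ {x} → x ∈ vs → g x ≡ h x

  agreementOn : List X → Setoid _ _
  agreementOn vs = record
    { Carrier       = X → A
    ; _≈_           = _≗[ vs ]_
    ; isEquivalence = record
      { refl  = λ _ → refl
      ; sym   = λ g≗h x∈ → sym (g≗h x∈)
      ; trans = λ g≗h h≗k x∈ → trans (g≗h x∈) (h≗k x∈)
      }
    }

  -- Each member is pinned down on vs only; elsewhere it takes the value default.
  selections : List X → List (X → A)
  selections []       = (λ _ → default) ∷ []
  selections (v ∷ vs) = cartesianProductWith (λ c g → g [ v ≔ c ]) (S v) (selections vs)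

  length-selections : ∀ vs → length (selections vs) ≡ product (map (length ∘ S) vs)
  length-selections []       = refl
  length-selections (v ∷ vs) =
    trans (length-cartesianProductWith _ (S v) (selections vs)) (cong (length (S v) *_) (length-selections vs))

  ∈-selections⁻ : ∀ {vs g x} → g ∈ selections vs → x ∈ vs → g x ∈ S x
  ∈-selections⁻ {v ∷ vs} {x = x} g∈ x∈ with ∈-cartesianProductWith⁻ _ (S v) (selections vs) g∈
  ... | c , h , c∈ , h∈ , refl with x ≟ v
  ...   | yes refl = c∈
  ...   | no  x≢v  = ∈-selections⁻ h∈ (in-tail x∈)
    where
    in-tail : x ∈ v ∷ vs → x ∈ vs
    in-tail (here x≡v) = contradiction x≡v x≢v
    in-tail (there x∈) = x∈

  selections-complete : ∀ {g} vs → (∀ {x} → x ∈ vs → g x ∈ S x) → Any (g ≗[ vs ]_) (selections vs)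
  selections-complete []       _  = here λ ()
  selections-complete {g} (v ∷ vs) g∈S =
    Any.cartesianProductWith⁺ _ agree (Any.map sym (g∈S (here refl))) (selections-complete vs (g∈S ∘ there))
    where
    agree : ∀ {c h} → c ≡ g v → g ≗[ vs ] h → g ≗[ v ∷ vs ] (h [ v ≔ c ])
    agree {c} {h} c≡gv g≗h {x} x∈ with x ≟ v
    ... | yes refl = sym c≡gv
    ... | no  x≢v  with x∈
    ...   | here x≡v = contradiction x≡v x≢v
    ...   | there x∈vs = g≗h x∈vs

  selections-unique : ∀ {vs} → Unique vs → (∀ x → Unique (S x)) → SetoidUnique.Unique (agreementOn vs) (selections vs)
  selections-unique {[]}     _            _  = All.[] AllPairs.∷ AllPairs.[]
  selections-unique {v ∷ vs} (v∉vs ∷ vs!) S! =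
    SetoidUnique.cartesianProductWith⁺ (setoid A) (agreementOn vs) (agreementOn (v ∷ vs)) _ injective (S! v)
      (selections-unique vs! S!)
    where
    injective : ∀ {c c′ h h′} → (h [ v ≔ c ]) ≗[ v ∷ vs ] (h′ [ v ≔ c′ ]) → c ≡ c′ × h ≗[ vs ] h′
    injective {c} {c′} {h} {h′} agree =
        trans (sym (update-≡ h v c)) (trans (agree (here refl)) (update-≡ h′ v c′))
      , λ {x} x∈ → let x≢v = λ x≡v → All.lookup v∉vs x∈ (sym x≡v) in
          trans (sym (update-≢ h c x≢v)) (trans (agree (there x∈)) (update-≢ h′ c′ x≢v))

canonical-wgt : ∀ m (v : V (suc m)) → canonical m v ≡ + wgt v - 1ℤ
canonical-wgt zero    (false ∷ []) = refl
canonical-wgt zero    (true  ∷ []) = refl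
canonical-wgt (suc m) (false ∷ v) =
  trans (cong (λ x → -1ℤ + x + 1ℤ) (canonical-wgt m v)) (-1+[w-1]+1≡w-1 (+ wgt v))
  where
  open +-*-Solver
  -1+[w-1]+1≡w-1 : ∀ w → -1ℤ + (w - 1ℤ) + 1ℤ ≡ w - 1ℤ
  -1+[w-1]+1≡w-1 = solve 1 (λ w → (con -1ℤ :+ (w :- con 1ℤ)) :+ con 1ℤ := w :- con 1ℤ) refl
canonical-wgt (suc m) (true  ∷ v) =
  trans (cong (λ x → 0ℤ + x + 1ℤ) (canonical-wgt m v)) (0+[w-1]+1≡[1+w]-1 (+ wgt v))
  where
  open +-*-Solver
  0+[w-1]+1≡[1+w]-1 : ∀ w → 0ℤ + (w - 1ℤ) + 1ℤ ≡ (+ 1 + w) - 1ℤ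
  0+[w-1]+1≡[1+w]-1 = solve 1 (λ w → (con 0ℤ :+ (w :- con 1ℤ)) :+ con 1ℤ := (con (+ 1) :+ w) :- con 1ℤ) refl

-- The values a member of dom(f) may take at a vertex where f takes the value d ≥ -1.
choices : ℤ → List ℤ
choices (+ k)    = map +_ (upTo (suc k))
choices -[1+ _ ] = -1ℤ ∷ []

choices-unique : ∀ d → Unique (choices d)
choices-unique (+ k)    = Unique.map⁺ ℤ.+-injective (Unique.upTo⁺ (suc k))
choices-unique -[1+ _ ] = All.[] ∷ []

length-choices : ∀ k → length (choices (+ k - 1ℤ)) ≡ 1 ⊔ k
length-choices zero    = refl
length-choices (suc k) = trans (length-map +_ (upTo (suc k))) (length-upTo (suc k))

∈-choices⁺ : ∀ {c d} → 0ℤ ≤ c → c ≤ d → c ∈ choices d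
∈-choices⁺ (+≤+ z≤n) (+≤+ i≤k) = ∈-map⁺ +_ (∈-upTo⁺ (s≤s i≤k))

∈-choices⇒≥-1 : ∀ {c} d → c ∈ choices d → -1ℤ ≤ c
∈-choices⇒≥-1 (+ k)    c∈ with ∈-map⁻ +_ c∈
... | _ , _ , refl = -≤+
∈-choices⇒≥-1 -[1+ _ ] (here refl) = ℤ.≤-refl

∈-choices⇒≤ : ∀ {c d} → -1ℤ ≤ d → c ∈ choices d → c ≤ d
∈-choices⇒≤ {d = + k}    _     c∈ with ∈-map⁻ +_ c∈
... | _ , i∈ , refl with ∈-upTo⁻ i∈
...   | s≤s i≤k = +≤+ i≤k
∈-choices⇒≤ {d = -[1+ _ ]} -1≤d (here refl) = -1≤d

∈-choices⇒≥0 : ∀ {c d} → 0ℤ ≤ d → c ∈ choices d → 0ℤ ≤ c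
∈-choices⇒≥0 {d = + k} _ c∈ with ∈-map⁻ +_ c∈
... | _ , _ , refl = +≤+ z≤n

_≟ⱽ_ : ∀ {n} → DecidableEquality (V n)
_≟ⱽ_ = ≡-dec Bool._≟_

-- Apply the parking condition to the singleton {v}.
parking-≥0 : ∀ {n g} → IsParking n g → ∀ {v} → v ≢ q n → 0ℤ ≤ g v
parking-≥0 {n} (_ , _ , parks) {v} v≢q
  with parks (λ w → does (w ≟ⱽ v)) (dec-false (q n ≟ⱽ v) (v≢q ∘ sym)) (v , dec-true (v ≟ⱽ v) refl)
... | w , w∈A , 0≤gw , _ with w ≟ⱽ v
...   | yes refl = 0≤gw
...   | no  _    = contradiction w∈A λ ()

inDom⇒choices : ∀ {n f g} → IsParking n f → InDom n f g → ∀ v → g v ∈ choices (f v)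
inDom⇒choices {n} f-parks (g-parks , g≤f) v with v ≟ⱽ q n
... | yes refl = subst₂ (λ c d → c ∈ choices d) (sym (proj₁ g-parks)) (sym (proj₁ f-parks)) (here refl)
... | no  v≢q  = ∈-choices⁺ (parking-≥0 g-parks v≢q) (g≤f v)

choices⇒inDom : ∀ {n f g} → IsParking n f → (∀ v → g v ∈ choices (f v)) → InDom n f g
choices⇒inDom {n} {f} {g} (fq≡-1 , f≥-1 , f-parks) g∈ = (gq≡-1 , g≥-1 , g-parks) , g≤f
  where
  g≥-1 : ∀ v → -1ℤ ≤ g v
  g≥-1 v = ∈-choices⇒≥-1 (f v) (g∈ v)
  g≤f : ∀ v → g v ≤ f v
  g≤f v = ∈-choices⇒≤ (f≥-1 v) (g∈ v)
  gq≡-1 : g (q n) ≡ -1ℤ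
  gq≡-1 = ℤ.≤-antisym (subst (g (q n) ≤_) fq≡-1 (g≤f (q n))) (g≥-1 (q n))
  g-parks : ∀ A → A (q n) ≡ false → (∃ λ v → A v ≡ true) → ∃ λ v → A v ≡ true × 0ℤ ≤ g v × g v < + dOut A v
  g-parks A Aq nonempty with f-parks A Aq nonempty
  ... | v , v∈A , 0≤fv , fv<d = v , v∈A , ∈-choices⇒≥0 0≤fv (g∈ v) , ℤ.≤-<-trans (g≤f v) fv<d

domCard : ∀ {n f} → IsParking n f → (vs : List (V n)) → (∀ v → v ∈ vs) → Unique vs →
  DomCard n f (product (map (length ∘ choices ∘ f) vs))
domCard {f = f} f-parks vs vs-complete vs-unique =
    selections vs
  , length-selections vs
  , (λ g∈ → choices⇒inDom f-parks (λ v → ∈-selections⁻ g∈ (vs-complete v)))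
  , (λ g g∈dom → Any.map (λ g≗h v → g≗h (vs-complete v))
                   (selections-complete vs (λ {v} _ → inDom⇒choices f-parks g∈dom v)))
  , AllPairs.map (λ g≉h g≗h → g≉h (λ {v} _ → g≗h v)) (selections-unique vs-unique (choices-unique ∘ f))
  where open Selections _≟ⱽ_ 0ℤ (choices ∘ f)

semiCanonical-domCard : ∀ m f → SemiCanonical m f → DomCard (suc m) f (prodFormula (suc m))
semiCanonical-domCard m f (f-parks , φ , (φ-injective , φ-surjective) , canonical≡f∘φ) =
  subst (DomCard n f) count
    (domCard f-parks (map φ (vertices n)) φ-image-complete (Unique.map⁺ φ-injective (vertices-unique n)))
  where
  n = suc m

  φ-image-complete : ∀ v → v ∈ map φ (vertices n)
  φ-image-complete v = subst (_∈ map φ (vertices n)) (proj₂ (φ-surjective v) refl) (∈-map⁺ φ (∈-vertices _))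

  length-choices-f∘φ : ∀ v → length (choices (f (φ v))) ≡ 1 ⊔ wgt v
  length-choices-f∘φ v = begin
    length (choices (f (φ v)))      ≡⟨ cong (length ∘ choices) (canonical≡f∘φ v) ⟨
    length (choices (canonical m v)) ≡⟨ cong (length ∘ choices) (canonical-wgt m v) ⟩
    length (choices (+ wgt v - 1ℤ))  ≡⟨ length-choices (wgt v) ⟩
    1 ⊔ wgt v                        ∎
    where open ≡-Reasoning

  count : product (map (length ∘ choices ∘ f) (map φ (vertices n))) ≡ prodFormula n
  count = begin
    product (map (length ∘ choices ∘ f) (map φ (vertices n))) ≡⟨ cong product (map-∘ (vertices n)) ⟨
    product (map (length ∘ choices ∘ f ∘ φ) (vertices n))     ≡⟨ cong product (map-cong length-choices-f∘φ (vertices n)) ⟩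
    product (map ((1 ⊔_) ∘ wgt) (vertices n))                 ≡⟨ product-vertices (1 ⊔_) n ⟩
    binomialProduct (1 ⊔_) n                                  ≡⟨ binomialProduct-prodFormula m ⟩
    prodFormula n                                             ∎
    where open ≡-Reasoning

mainTheorem11 : (m : ℕ) →
    (∀ (v : V (suc m)) → canonical m v ≡ + wgt v - 1ℤ) ×
    (∀ (f : V (suc m) → ℤ) → SemiCanonical m f → DomCard (suc m) f (prodFormula (suc m)))
mainTheorem11 m = canonical-wgt m , semiCanonical-domCard m
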